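{- Let $P$ be a finite poset and $x,y\in P$ with $x\neq y$ and $x\prec y$. Then $\Delta(P)$ $\mathrm{LC}$-reduces to $\Delta(P\setminus\{x\})$.
   Context: $\Delta(P)$ is the order complex (vertex set $P$, faces the chains); $\Delta(P\setminus\{x\})$ is the order complex of the induced subposet. Elements $z,x$ are comparable if $z\le x$ or $x\le z$; $x\prec y$ means every element comparable with $x$ is comparable with $y$. For a simplicial complex $\Delta$ with vertex set $V$, $\mathcal{F}(v)$ is the set of facets (maximal faces) containing $v$; for $\kappa\colon V\to[k]=\{1,\dots,k\}$ and a face $S$, $S_\kappa(t)=|\{v\in S:\kappa(v)=t\}|$; a $k$-linear coloring is a surjective $\kappa$ with $\sum_t\min(F_\kappa(t),F'_\kappa(t))=|F\cap F'|$ for all facets $F,F'$. A representative subcomplex w.r.t. $\kappa$ is the subcomplex induced on a set $W\subseteq V$ with exactly one vertex of each color such that $\mathcal{F}(u)\subseteq\mathcal{F}(w)$ whenever $u\in V$, $w\in W$, $\kappa(u)=\kappa(w)$. $\Delta$ $\mathrm{LC}$-reduces to $\Delta'$ if there is a sequence $\Delta=\Delta_0\supseteq\dots\supseteq\Delta_t=\Delta'$ with each $\Delta_{r+1}$ a representative subcomplex of $\Delta_r$ w.r.t. some linear coloring of $\Delta_r$. -}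

module Defs where

open import Data.Nat using (ℕ; _⊓_)
open import Data.Fin using (Fin; _≟_)
open import Data.Fin.Subset using (Subset; _∈_; _∉_; _⊆_; _∩_; ∣_∣; ⁅_⁆)
open import Data.List using (map; allFin)
open import Data.Nat.ListAction using (sum)
open import Data.Vec using (tabulate)
open import Data.Product using (Σ; _×_; ∃)
open import Data.Sum using (_⊎_)
open import Function.Bundles using (_⇔_)
open import Relation.Nullary using (does)
open import Relation.Binary.PropositionalEquality using (_≡_)

-- A simplicial complex on the ambient set Fin n, given by its set of faces.
-- (Downward-closedness is recorded separately in IsComplex.)
Complex : ℕ → Set₁
Complex n = Subset n → Set

IsComplex : ∀ {n} → Complex n → Set
IsComplex {n} Δ = ∀ (S T : Subset n) → Δ S → T ⊆ S → Δ T

Vertex : ∀ {n} → Complex n → Fin n → Set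
Vertex Δ v = Δ ⁅ v ⁆

Facet : ∀ {n} → Complex n → Subset n → Set
Facet {n} Δ F = Δ F × (∀ (G : Subset n) → Δ G → F ⊆ G → G ⊆ F)

colorClass : ∀ {n k} → (Fin n → Fin k) → Fin k → Subset n
colorClass κ t = tabulate (λ v → does (κ v ≟ t))

count : ∀ {n k} → (Fin n → Fin k) → Subset n → Fin k → ℕ
count κ S t = ∣ S ∩ colorClass κ t ∣

-- k-linear coloring (κ is only relevant on the vertex set; surjective from V)
IsLinearColoring : ∀ {n} → Complex n → (k : ℕ) → (Fin n → Fin k) → Set
IsLinearColoring {n} Δ k κ =
  (∀ (t : Fin k) → ∃ λ v → Vertex Δ v × κ v ≡ t) ×
  (∀ (F F' : Subset n) → Facet Δ F → Facet Δ F' →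
     sum (map (λ t → count κ F t ⊓ count κ F' t) (allFin k)) ≡ ∣ F ∩ F' ∣)

IsRepresentative : ∀ {n k} → Complex n → (Fin n → Fin k) → Subset n → Set
IsRepresentative {n} {k} Δ κ W =
  (∀ w → w ∈ W → Vertex Δ w) ×
  (∀ (t : Fin k) → ∣ W ∩ colorClass κ t ∣ ≡ 1) ×
  (∀ u w → Vertex Δ u → w ∈ W → κ u ≡ κ w →
     ∀ (F : Subset n) → Facet Δ F → u ∈ F → w ∈ F)

Induced : ∀ {n} → Complex n → Subset n → Complex n
Induced Δ W S = Δ S × S ⊆ W

data LCReduces {n : ℕ} : Complex n → Complex n → Set₁ where
  done : ∀ {Δ Δ' : Complex n} → (∀ S → Δ S ⇔ Δ' S) → LCReduces Δ Δ'
  step : ∀ {Δ Δ' : Complex n} (k : ℕ) (κ : Fin n → Fin k) (W : Subset n) →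
         IsLinearColoring Δ k κ → IsRepresentative Δ κ W →
         LCReduces (Induced Δ W) Δ' → LCReduces Δ Δ'

Comparable : ∀ {n} → (Fin n → Fin n → Set) → Fin n → Fin n → Set
Comparable _≤_ a b = a ≤ b ⊎ b ≤ a

OrderComplex : ∀ {n} → (Fin n → Fin n → Set) → Complex n
OrderComplex _≤_ S = ∀ a b → a ∈ S → b ∈ S → Comparable _≤_ a b

-- order complex of the induced subposet P ∖ {x}
OrderComplexMinus : ∀ {n} → (Fin n → Fin n → Set) → Fin n → Complex n
OrderComplexMinus _≤_ x S = OrderComplex _≤_ S × x ∉ S

Dominated : ∀ {n} → (Fin n → Fin n → Set) → Fin n → Fin n → Set
Dominated _≤_ x y = ∀ z → Comparable _≤_ z x → Comparable _≤_ z y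

-- Give x the colour of y and every other element its own colour. Every maximal chain through x
-- contains y, because adding y to a chain through x keeps it a chain (every element comparable
-- with x is comparable with y). So on each facet the colour class {x, y} meets it in ∅, {y} or
-- {x, y}: the traces of any two facets on a colour class are nested, which makes the colouring
-- linear, and P ∖ {x}, one element of each colour, is a representative set inducing Δ(P ∖ {x}).
module Submission where

open import Defs
open import Data.Bool using (true; false; _∧_; if_then_else_)
open import Data.Fin using (Fin; zero; suc; _≟_; punchIn; punchOut)
open import Data.Fin.Properties
  using (punchOut-cong; punchOut-injective; punchOut-punchIn; punchInᵢ≢i; any?)
open import Data.Fin.Subset using (Subset; _∈_; _∉_; _⊆_; _∩_; _∪_; ∁; ∣_∣; ⁅_⁆)
open import Data.Fin.Subset.Properties
  using (_∈?_; x∈p∩q⁺; x∈p∩q⁻; x∈p∪q⁻; p⊆p∪q; q⊆p∪q; x∈⁅x⁆; x∈⁅y⁆⇒x≡y; x∉⁅y⁆⇒x≢y; x≢y⇒x∉⁅y⁆;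
         x∈∁p⇒x∉p; x∉p⇒x∈∁p; ⊆-antisym; p⊆q⇒∣p∣≤∣q∣; ∣⁅x⁆∣≡1; ∩-comm)
open import Data.List using (map; allFin; tabulate)
open import Data.List.Properties using (map-tabulate)
open import Data.Nat using (ℕ; zero; suc; _+_; _⊓_; _≤_)
open import Data.Nat.ListAction using (sum)
open import Data.Nat.Properties using (+-0-commutativeMonoid; m≤n⇒m⊓n≡m; ⊓-comm)
open import Data.Product using (_,_; proj₁)
open import Data.Product.Function.NonDependent.Propositional using (_×-⇔_)
open import Data.Sum using (_⊎_; inj₁; inj₂; swap)
open import Data.Vec using ([]; _∷_)
open import Data.Vec.Properties using (lookup∘tabulate; []=⇒lookup; lookup⇒[]=)
open import Function using (id; _∘_)
open import Function.Bundles using (_⇔_; mk⇔)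
open import Function.Construct.Composition using (_⇔-∘_)
open import Function.Construct.Identity using (⇔-id)
open import Relation.Binary.Definitions using (Reflexive)
open import Relation.Binary.PropositionalEquality
  using (_≡_; _≢_; refl; sym; trans; cong; cong₂; subst; ≢-sym; module ≡-Reasoning)
open import Relation.Binary.Structures using (IsDecPartialOrder)
open import Relation.Nullary using (¬_; Dec; yes; no; does; contradiction)
open import Relation.Nullary.Decidable using (_×-dec_; ¬?; dec-true; decidable-stable)
open import Algebra.Properties.CommutativeMonoid.Sum +-0-commutativeMonoid
  using (sum-cong-≗; ∑-distrib-+; sum-replicate-zero) renaming (sum to ∑)

LCReduces-respʳ : ∀ {n} {Δ Δ₁ Δ₂ : Complex n} →
  (∀ S → Δ₁ S ⇔ Δ₂ S) → LCReduces Δ Δ₁ → LCReduces Δ Δ₂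
LCReduces-respʳ Δ₁⇔Δ₂ (done Δ⇔Δ₁)            = done (λ S → Δ₁⇔Δ₂ S ⇔-∘ Δ⇔Δ₁ S)
LCReduces-respʳ Δ₁⇔Δ₂ (step k κ W lin rep r) = step k κ W lin rep (LCReduces-respʳ Δ₁⇔Δ₂ r)

sum-tabulate : ∀ {k} (f : Fin k → ℕ) → sum (tabulate f) ≡ ∑ f
sum-tabulate {zero}  f = refl
sum-tabulate {suc k} f = cong (f zero +_) (sum-tabulate (f ∘ suc))

sum-allFin : ∀ {k} (f : Fin k → ℕ) → sum (map f (allFin k)) ≡ ∑ f
sum-allFin {k} f = trans (cong sum (map-tabulate id f)) (sum-tabulate f)

∑-δ : ∀ {k} (c : Fin k) → ∑ (λ t → if does (c ≟ t) then 1 else 0) ≡ 1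
∑-δ {suc k} zero    = cong suc (sum-replicate-zero k)
∑-δ {suc k} (suc c) = ∑-δ c

∣∷∣ : ∀ {n} b (p : Subset n) → ∣ b ∷ p ∣ ≡ (if b then 1 else 0) + ∣ p ∣
∣∷∣ false p = refl
∣∷∣ true  p = refl

∑-count : ∀ {n k} (κ : Fin n → Fin k) (S : Subset n) → ∑ (count κ S) ≡ ∣ S ∣
∑-count {zero}  {k} κ []      = sum-replicate-zero k
∑-count {suc n} {k} κ (s ∷ S) = begin
  ∑ (count κ (s ∷ S))
    ≡⟨ sum-cong-≗ (λ t → ∣∷∣ (s ∧ does (κ zero ≟ t)) (S ∩ colorClass (κ ∘ suc) t)) ⟩
  ∑ (λ t → (if s ∧ does (κ zero ≟ t) then 1 else 0) + count (κ ∘ suc) S t)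
    ≡⟨ ∑-distrib-+ (λ t → if s ∧ does (κ zero ≟ t) then 1 else 0) (count (κ ∘ suc) S) ⟩
  ∑ (λ t → if s ∧ does (κ zero ≟ t) then 1 else 0) + ∑ (count (κ ∘ suc) S)
    ≡⟨ cong₂ _+_ (∑-head s) (∑-count (κ ∘ suc) S) ⟩
  (if s then 1 else 0) + ∣ S ∣
    ≡⟨ ∣∷∣ s S ⟨
  ∣ s ∷ S ∣ ∎
  where
  open ≡-Reasoning
  ∑-head : ∀ s → ∑ (λ t → if s ∧ does (κ zero ≟ t) then 1 else 0) ≡ (if s then 1 else 0)
  ∑-head false = sum-replicate-zero k
  ∑-head true  = ∑-δ (κ zero)

module _ {n k} (κ : Fin n → Fin k) where

  ∈-colorClass⁻ : ∀ {v t} → v ∈ colorClass κ t → κ v ≡ t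
  ∈-colorClass⁻ {v} {t} v∈C with κ v ≟ t | trans (sym (lookup∘tabulate _ v)) ([]=⇒lookup v∈C)
  ... | yes κv≡t | _ = κv≡t
  ... | no _     | ()

  ∈-colorClass⁺ : ∀ {v t} → κ v ≡ t → v ∈ colorClass κ t
  ∈-colorClass⁺ {v} {t} κv≡t =
    lookup⇒[]= v _ (trans (lookup∘tabulate _ v) (dec-true (κ v ≟ t) κv≡t))

  _⊆[_]_ : Subset n → Fin k → Subset n → Set
  F ⊆[ t ] F' = ∀ {a} → a ∈ F → κ a ≡ t → a ∈ F'

  count-mono : ∀ {F F' t} → F ⊆[ t ] F' → count κ F t ≤ count κ F' t
  count-mono {F} {F'} {t} F⊆F' = p⊆q⇒∣p∣≤∣q∣ λ a∈ →
    let a∈F , a∈C = x∈p∩q⁻ F (colorClass κ t) a∈ in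
    x∈p∩q⁺ (F⊆F' a∈F (∈-colorClass⁻ a∈C) , a∈C)

  count-∩ : ∀ {F F' t} → F ⊆[ t ] F' → count κ (F ∩ F') t ≡ count κ F t
  count-∩ {F} {F'} {t} F⊆F' = cong ∣_∣ (⊆-antisym shrink grow)
    where
    C = colorClass κ t
    shrink : (F ∩ F') ∩ C ⊆ F ∩ C
    shrink a∈ = let a∈F∩F' , a∈C = x∈p∩q⁻ (F ∩ F') C a∈ in
      x∈p∩q⁺ (proj₁ (x∈p∩q⁻ F F' a∈F∩F') , a∈C)
    grow : F ∩ C ⊆ (F ∩ F') ∩ C
    grow a∈ = let a∈F , a∈C = x∈p∩q⁻ F C a∈ in
      x∈p∩q⁺ (x∈p∩q⁺ (a∈F , F⊆F' a∈F (∈-colorClass⁻ a∈C)) , a∈C)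

  ⊓-count : ∀ {F F' t} → F ⊆[ t ] F' → count κ F t ⊓ count κ F' t ≡ count κ (F ∩ F') t
  ⊓-count F⊆F' = trans (m≤n⇒m⊓n≡m (count-mono F⊆F')) (sym (count-∩ F⊆F'))

  ⊓-count-nested : ∀ {F F' t} → F ⊆[ t ] F' ⊎ F' ⊆[ t ] F →
    count κ F t ⊓ count κ F' t ≡ count κ (F ∩ F') t
  ⊓-count-nested (inj₁ F⊆F') = ⊓-count F⊆F'
  ⊓-count-nested {F} {F'} {t} (inj₂ F'⊆F) = begin
    count κ F t ⊓ count κ F' t ≡⟨ ⊓-comm (count κ F t) _ ⟩
    count κ F' t ⊓ count κ F t ≡⟨ ⊓-count F'⊆F ⟩
    count κ (F' ∩ F) t         ≡⟨ cong (λ S → count κ S t) (∩-comm F' F) ⟩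
    count κ (F ∩ F') t         ∎
    where open ≡-Reasoning

  sum-⊓-count : ∀ {F F'} → (∀ t → F ⊆[ t ] F' ⊎ F' ⊆[ t ] F) →
    sum (map (λ t → count κ F t ⊓ count κ F' t) (allFin k)) ≡ ∣ F ∩ F' ∣
  sum-⊓-count {F} {F'} nested = begin
    sum (map ⊓-counts (allFin k)) ≡⟨ sum-allFin ⊓-counts ⟩
    ∑ ⊓-counts                   ≡⟨ sum-cong-≗ (⊓-count-nested ∘ nested) ⟩
    ∑ (count κ (F ∩ F'))          ≡⟨ ∑-count κ (F ∩ F') ⟩
    ∣ F ∩ F' ∣                    ∎
    where
    open ≡-Reasoning
    ⊓-counts : Fin k → ℕ
    ⊓-counts t = count κ F t ⊓ count κ F' t

  ColourExchange : Subset n → Subset n → Set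
  ColourExchange F F' = ∀ {a b} → κ a ≡ κ b → a ∈ F → a ∉ F' → b ∈ F' → b ∈ F

  exchange⇒nested : ∀ {F F'} → ColourExchange F F' → ∀ t → F ⊆[ t ] F' ⊎ F' ⊆[ t ] F
  exchange⇒nested {F} {F'} exchange t
    with any? (λ a → (a ∈? F) ×-dec ((κ a ≟ t) ×-dec ¬? (a ∈? F')))
  ... | yes (a , a∈F , κa≡t , a∉F') =
    inj₂ λ b∈F' κb≡t → exchange (trans κa≡t (sym κb≡t)) a∈F a∉F' b∈F'
  ... | no ∄a = inj₁ λ {a} a∈F κa≡t →
    decidable-stable (a ∈? F') (λ a∉F' → ∄a (a , a∈F , κa≡t , a∉F'))

module Merge {m} {x y : Fin (suc m)} (x≢y : x ≢ y) where

  merge : Fin (suc m) → Fin m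
  merge v with x ≟ v
  ... | yes _   = punchOut x≢y
  ... | no x≢v  = punchOut x≢v

  merge-punchOut : ∀ {v} (x≢v : x ≢ v) → merge v ≡ punchOut x≢v
  merge-punchOut {v} x≢v with x ≟ v
  ... | yes x≡v = contradiction x≡v x≢v
  ... | no _    = punchOut-cong x refl

  merge-x≡merge-y : merge x ≡ merge y
  merge-x≡merge-y with x ≟ x
  ... | yes _   = sym (merge-punchOut x≢y)
  ... | no x≢x  = contradiction refl x≢x

  merge-injective : ∀ {a b} → x ≢ a → x ≢ b → merge a ≡ merge b → a ≡ b
  merge-injective x≢a x≢b ma≡mb = punchOut-injective x≢a x≢b
    (trans (sym (merge-punchOut x≢a)) (trans ma≡mb (merge-punchOut x≢b)))

  merge≡merge-x : ∀ {a} → x ≢ a → merge a ≡ merge x → a ≡ y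
  merge≡merge-x x≢a ma≡mx = merge-injective x≢a x≢y (trans ma≡mx merge-x≡merge-y)

  merge-punchIn : ∀ t → merge (punchIn x t) ≡ t
  merge-punchIn t = trans (merge-punchOut (punchInᵢ≢i x t ∘ sym)) (punchOut-punchIn x)

  merge≡⇒punchIn : ∀ {v t} → x ≢ v → merge v ≡ t → v ≡ punchIn x t
  merge≡⇒punchIn {t = t} x≢v mv≡t =
    merge-injective x≢v (punchInᵢ≢i x t ∘ sym) (trans mv≡t (sym (merge-punchIn t)))

  merge-exchange : ∀ {F F'} → (x ∈ F → y ∈ F) → (x ∈ F' → y ∈ F') → ColourExchange merge F F'
  merge-exchange {F} {F'} closedF closedF' {a} {b} = by-cases (x ≟ a) (x ≟ b)
    where
    -- The tests are passed as arguments: a `with` on x ≟ a would also abstract it inside merge a.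
    by-cases : ∀ {a b} → Dec (x ≡ a) → Dec (x ≡ b) →
      merge a ≡ merge b → a ∈ F → a ∉ F' → b ∈ F' → b ∈ F
    by-cases (yes refl) (yes refl) _ a∈F _ _ = a∈F
    by-cases (yes refl) (no x≢b) mx≡mb a∈F _ _ =
      subst (_∈ F) (sym (merge≡merge-x x≢b (sym mx≡mb))) (closedF a∈F)
    by-cases (no x≢a) (yes refl) ma≡mx _ a∉F' x∈F' =
      contradiction (subst (_∈ F') (sym (merge≡merge-x x≢a ma≡mx)) (closedF' x∈F')) a∉F'
    by-cases (no x≢a) (no x≢b) ma≡mb a∈F _ _ = subst (_∈ F) (merge-injective x≢a x≢b ma≡mb) a∈F

FacetDominated : ∀ {n} → Complex n → Fin n → Fin n → Set
FacetDominated {n} Δ x y = ∀ (F : Subset n) → Facet Δ F → x ∈ F → y ∈ F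

∈∁⁅⁆⇒≢ : ∀ {n} {x v : Fin n} → v ∈ ∁ ⁅ x ⁆ → x ≢ v
∈∁⁅⁆⇒≢ v∈ = ≢-sym (x∉⁅y⁆⇒x≢y (x∈∁p⇒x∉p v∈))

≢⇒∈∁⁅⁆ : ∀ {n} {x v : Fin n} → x ≢ v → v ∈ ∁ ⁅ x ⁆
≢⇒∈∁⁅⁆ x≢v = x∉p⇒x∈∁p (x≢y⇒x∉⁅y⁆ (≢-sym x≢v))

⊆∁⁅⁆⇔∉ : ∀ {n} {x : Fin n} {S : Subset n} → S ⊆ ∁ ⁅ x ⁆ ⇔ x ∉ S
⊆∁⁅⁆⇔∉ {x = x} {S} = mk⇔
  (λ S⊆ x∈S → ∈∁⁅⁆⇒≢ (S⊆ x∈S) refl)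
  (λ x∉S {v} v∈S → ≢⇒∈∁⁅⁆ λ x≡v → x∉S (subst (_∈ S) (sym x≡v) v∈S))

module _ {m} {Δ : Complex (suc m)} {x y : Fin (suc m)} (vertex : ∀ v → Vertex Δ v)
         (x≢y : x ≢ y) (𝓕x⊆𝓕y : FacetDominated Δ x y) where

  open Merge x≢y

  merge-linear : IsLinearColoring Δ m merge
  merge-linear = (λ t → punchIn x t , vertex _ , merge-punchIn t) ,
    λ F F' facetF facetF' →
      sum-⊓-count merge (exchange⇒nested merge (merge-exchange (𝓕x⊆𝓕y F facetF) (𝓕x⊆𝓕y F' facetF')))

  ∁⁅x⁆∩colorClass : ∀ t → ∁ ⁅ x ⁆ ∩ colorClass merge t ≡ ⁅ punchIn x t ⁆
  ∁⁅x⁆∩colorClass t = ⊆-antisym ⊆⁅⁆ ⁅⁆⊆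
    where
    ⊆⁅⁆ : ∁ ⁅ x ⁆ ∩ colorClass merge t ⊆ ⁅ punchIn x t ⁆
    ⊆⁅⁆ v∈ = let v∈W , v∈C = x∈p∩q⁻ (∁ ⁅ x ⁆) _ v∈ in
      subst (_∈ ⁅ punchIn x t ⁆) (sym (merge≡⇒punchIn (∈∁⁅⁆⇒≢ v∈W) (∈-colorClass⁻ merge v∈C)))
        (x∈⁅x⁆ _)
    ⁅⁆⊆ : ⁅ punchIn x t ⁆ ⊆ ∁ ⁅ x ⁆ ∩ colorClass merge t
    ⁅⁆⊆ v∈ rewrite x∈⁅y⁆⇒x≡y _ v∈ =
      x∈p∩q⁺ (≢⇒∈∁⁅⁆ (punchInᵢ≢i x t ∘ sym) , ∈-colorClass⁺ merge (merge-punchIn t))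

  ∁⁅x⁆-representative : IsRepresentative Δ merge (∁ ⁅ x ⁆)
  ∁⁅x⁆-representative =
    (λ w _ → vertex w) ,
    (λ t → trans (cong ∣_∣ (∁⁅x⁆∩colorClass t)) (∣⁅x⁆∣≡1 (punchIn x t))) ,
    λ u w _ w∈W mu≡mw F facetF u∈F → by-cases (x ≟ u) (∈∁⁅⁆⇒≢ w∈W) mu≡mw (𝓕x⊆𝓕y F facetF) u∈F
    where
    by-cases : ∀ {u w F} → Dec (x ≡ u) → x ≢ w → merge u ≡ merge w → (x ∈ F → y ∈ F) → u ∈ F → w ∈ F
    by-cases (yes refl) x≢w mx≡mw closedF x∈F =
      subst (_∈ _) (sym (merge≡merge-x x≢w (sym mx≡mw))) (closedF x∈F)
    by-cases (no x≢u) x≢w mu≡mw _ u∈F = subst (_∈ _) (merge-injective x≢u x≢w mu≡mw) u∈F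

  facetDominated⇒LCReduces : LCReduces Δ (Induced Δ (∁ ⁅ x ⁆))
  facetDominated⇒LCReduces =
    step m merge (∁ ⁅ x ⁆) merge-linear ∁⁅x⁆-representative (done (λ S → ⇔-id _))

module _ {n} {_≤_ : Fin n → Fin n → Set} (≤-refl : Reflexive _≤_) where

  singleton-chain : ∀ v → Vertex (OrderComplex _≤_) v
  singleton-chain v a b a∈ b∈ rewrite x∈⁅y⁆⇒x≡y v a∈ | x∈⁅y⁆⇒x≡y v b∈ = inj₁ ≤-refl

  chain-∪-⁅⁆ : ∀ {F y} → OrderComplex _≤_ F → (∀ {a} → a ∈ F → Comparable _≤_ a y) →
    OrderComplex _≤_ (F ∪ ⁅ y ⁆)
  chain-∪-⁅⁆ {F} {y} chain ≍y a b a∈ b∈ with x∈p∪q⁻ F ⁅ y ⁆ a∈ | x∈p∪q⁻ F ⁅ y ⁆ b∈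
  ... | inj₁ a∈F | inj₁ b∈F = chain a b a∈F b∈F
  ... | inj₁ a∈F | inj₂ b∈y rewrite x∈⁅y⁆⇒x≡y y b∈y = ≍y a∈F
  ... | inj₂ a∈y | inj₁ b∈F rewrite x∈⁅y⁆⇒x≡y y a∈y = swap (≍y b∈F)
  ... | inj₂ a∈y | inj₂ b∈y rewrite x∈⁅y⁆⇒x≡y y a∈y | x∈⁅y⁆⇒x≡y y b∈y = inj₁ ≤-refl

  dominated⇒facetDominated : ∀ {x y} → Dominated _≤_ x y → FacetDominated (OrderComplex _≤_) x y
  dominated⇒facetDominated {x} {y} x≺y F (chain , maximal) x∈F =
    maximal (F ∪ ⁅ y ⁆) (chain-∪-⁅⁆ chain λ a∈F → x≺y _ (chain _ x a∈F x∈F)) (p⊆p∪q ⁅ y ⁆)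
      (q⊆p∪q F ⁅ y ⁆ (x∈⁅x⁆ y))

proposition7p4 : (n : ℕ) (_≤_ : Fin n → Fin n → Set) → IsDecPartialOrder _≡_ _≤_ →
    (x y : Fin n) → ¬ (x ≡ y) → Dominated _≤_ x y →
    LCReduces (OrderComplex _≤_) (OrderComplexMinus _≤_ x)
proposition7p4 zero    _≤_ po ()
proposition7p4 (suc m) _≤_ po x y x≢y x≺y =
  LCReduces-respʳ (λ S → ⇔-id _ ×-⇔ ⊆∁⁅⁆⇔∉)
    (facetDominated⇒LCReduces (singleton-chain ≤-refl) x≢y (dominated⇒facetDominated ≤-refl x≺y))
  where open IsDecPartialOrder po using () renaming (refl to ≤-refl)
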